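{- Let $k\ge 3$ and $2k-1<n<3k-2$, and put $m=n-2k+1$. Then $W^{(k)}_n$ has exactly two maximal straddling palindromes: one is the $(k\oplus W^{(k)}_m,\ k\oplus(W^{(k)}_m m^{ -1}))$-straddling palindrome, and the other is the $(k\oplus W^{(k)}_m,\ k\oplus(W^{(k)}_m W^{(k)}_m m^{ -1}))$-straddling palindrome.
   Context: The alphabet is $\mathbb{N}=\{0,1,2,\dots\}$. For an integer $k\ge 3$, $\varphi_k$ is the morphism of $\mathbb{N}^*$ defined on letters, for $i\ge 0$ and $0\le j\le k-1$, by $\varphi_k(ki+j)=(ki)(ki+j+1)$ (two letters) if $0\le j\le k-2$, and $\varphi_k(ki+k-1)=(ki+k)$ (one letter). For $n\ge 0$, $W^{(k)}_n=\varphi_k^n(0)$; for $W=w_1\cdots w_r$, $W[s,t]=w_s\cdots w_t$; $c\oplus W$ adds $c$ to every letter of $W$; for a word $W$ ending with letter $a$, $Wa^{ -1}$ is $W$ with its last letter deleted. For $n\ge k$ let $e=\sum_{i=n-k+1}^{n-1}|W^{(k)}_i|$ (the length of the part $W^{(k)}_{n-1}\cdots W^{(k)}_{n-k+1}$ preceding the final block $k\oplus W^{(k)}_{n-k}$ of $W^{(k)}_n$). A straddling palindrome of $W^{(k)}_n$ is a pair $(s,t)$ with $1\le s\le e<t\le|W^{(k)}_n|$ such that $W^{(k)}_n[s,t]$ is a palindrome; it is an $(A,B)$-straddling palindrome if $W^{(k)}_n[s,e]=A$ and $W^{(k)}_n[e+1,t]=B$. It is maximal if there is no straddling palindrome $(s',t')$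 with $s'+t'=s+t$ and $t'-s'>t-s$. -}

module Defs where

open import Data.Nat using (ℕ; zero; suc; _+_; _∸_; _≤_; _<_; _>_; _≡ᵇ_)
open import Data.Nat.DivMod using (_%_)
open import Data.Bool using (if_then_else_)
open import Data.List using (List; []; _∷_; [_]; map; concatMap; length; take; drop; reverse; applyUpTo)
open import Data.Nat.ListAction using (sum)
open import Data.Product using (_×_; Σ)
open import Relation.Binary.PropositionalEquality using (_≡_)
open import Relation.Nullary using (¬_)

Word : Set
Word = List ℕ

-- φ_k on a letter a = k i + j (0 ≤ j ≤ k-1):
--   j ≤ k-2 : (k i)(k i + j + 1) = (a ∸ j)(a + 1)
--   j = k-1 : (k i + k)          = (a + 1)
-- The case k = 0 is junk (never used; the theorem assumes k ≥ 3).
φLetter : ℕ → ℕ → Word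
φLetter zero    a = []
φLetter (suc k) a =
  if (a % suc k) ≡ᵇ k then (a + 1) ∷ [] else (a ∸ (a % suc k)) ∷ (a + 1) ∷ []

φ : ℕ → Word → Word
φ k = concatMap (φLetter k)

W : ℕ → ℕ → Word
W k zero    = 0 ∷ []
W k (suc n) = φ k (W k n)

-- e = Σ_{i = n-k+1}^{n-1} |W^{(k)}_i|   (for n ≥ k)
e : ℕ → ℕ → ℕ
e k n = sum (applyUpTo (λ j → length (W k ((n + 1 ∸ k) + j))) (k ∸ 1))

-- factor W[s,t] = w_s ⋯ w_t (1-indexed, inclusive)
factor : Word → ℕ → ℕ → Word
factor w s t = take (suc t ∸ s) (drop (s ∸ 1) w)

_⊕_ : ℕ → Word → Word
c ⊕ w = map (c +_) w

-- W a⁻¹ : delete the last letter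
dropLast : Word → Word
dropLast []           = []
dropLast (x ∷ [])     = []
dropLast (x ∷ y ∷ xs) = x ∷ dropLast (y ∷ xs)

IsPalindrome : Word → Set
IsPalindrome w = reverse w ≡ w

Straddling : ℕ → ℕ → ℕ → ℕ → Set
Straddling k n s t =
  (1 ≤ s) × (s ≤ e k n) × (e k n < t) × (t ≤ length (W k n))
  × IsPalindrome (factor (W k n) s t)

ABStraddling : ℕ → ℕ → Word → Word → ℕ → ℕ → Set
ABStraddling k n A B s t =
  Straddling k n s t
  × (factor (W k n) s (e k n) ≡ A)
  × (factor (W k n) (suc (e k n)) t ≡ B)

Maximal : ℕ → ℕ → ℕ → ℕ → Set
Maximal k n s t =
  Straddling k n s t
  × (∀ s′ t′ → Straddling k n s′ t′ → s′ + t′ ≡ s + t → ¬ (t′ ∸ s′ > t ∸ s))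

-- Let m = n − 2k + 1 and V = W_{k+m−1}.  Unfolding W_j = W_{j−1} ⋯ W_{j−k+1} (k ⊕ W_{j−k})
-- twice, and using W_j = Z_j j for the Zimin words Z_0 = ε, Z_{j+1} = Z_j j Z_j (j < k), the
-- letters of W_n around position e read  (m + 1) · k ⊕ (Z_m m) | k ⊕ V,  where V begins with
-- Z_m m Z_m.  A straddling palindrome cannot reach back to the letter m + 1: its mirror image
-- would be preceded by a letter ≥ k, whereas in an image of φ_k every letter of [1, k) is
-- preceded by 0.  So the palindrome lies inside k ⊕ (Z_m m V) and contains the letter k + m at
-- position e.  Either it is centred there, or k + m is mirrored to an occurrence of m in V that
-- follows a palindromic prefix of V, and since V begins with W_k = φ_k(Z_{k−1}) k while
-- Z_k = φ_k(Z_{k−1}) 0, that prefix is Z_m.  On each of the two centres the longest palindrome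
-- starts right after m + 1: it is k ⊕ (Z_m m Z_m), resp. k ⊕ (Z_m m Z_m m Z_m).

module Submission where

open import Defs
open import Data.Nat using (ℕ; _+_; _*_; _∸_; _≤_; _<_)
open import Data.List using (_++_)
open import Data.Product using (_×_; Σ-syntax; _,_)
open import Data.Sum using (_⊎_)
open import Relation.Binary.PropositionalEquality using (_≡_; _≢_)
open import Function.Bundles using (_⇔_)

open import Data.Bool using (true; false; T)
open import Data.List using ([]; _∷_; [_]; _∷ʳ_; take; drop; reverse; length; applyUpTo)
open import Data.List.Properties
  using (length-++; length-map; length-take; length-drop; length-reverse; length-++-≤ˡ;
         map-++; take-map; drop-map; reverse-++; unfold-reverse; reverse-map; concatMap-++;
         ++-assoc; ++-identityʳ; ∷ʳ-++; ∷ʳ-injectiveˡ)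
open import Data.Nat using (zero; suc; z≤n; s≤s; s≤s⁻¹; _⊓_; _>_; _≡ᵇ_; _<?_)
open import Data.Nat.DivMod using (_%_; _/_; m%n≤m; m<n⇒m%n≡m; [m+n]%n≡m%n; m≡m%n+[m/n]*n)
open import Data.Nat.ListAction using (sum)
open import Data.Nat.Properties
open import Algebra.Properties.CommutativeSemigroup +-commutativeSemigroup using (interchange)
open import Data.Nat.Tactic.RingSolver using (solve-∀)
open import Data.Product using (proj₁; proj₂)
open import Data.Sum using (inj₁; inj₂)
import Data.Sum as Sum
open import Data.Unit using (⊤; tt)
open import Function using (_∘_)
open import Function.Bundles using (mk⇔)
open import Relation.Binary.PropositionalEquality
  using (refl; sym; trans; cong; cong₂; subst; subst₂; module ≡-Reasoning)
open import Relation.Nullary using (¬_; contradiction; yes; no)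

infixl 20 _!_

-- Out-of-range positions read as 0; every lookup below is in range.
_!_ : Word → ℕ → ℕ
[] ! _ = 0
(x ∷ xs) ! zero = x
(x ∷ xs) ! suc i = xs ! i

!-++ˡ : ∀ xs ys {i} → i < length xs → (xs ++ ys) ! i ≡ xs ! i
!-++ˡ (x ∷ xs) ys {zero} _ = refl
!-++ˡ (x ∷ xs) ys {suc i} (s≤s i<n) = !-++ˡ xs ys i<n

!-++ʳ : ∀ xs ys i → (xs ++ ys) ! (length xs + i) ≡ ys ! i
!-++ʳ [] ys i = refl
!-++ʳ (x ∷ xs) ys i = !-++ʳ xs ys i

!-⊕ : ∀ c xs {i} → i < length xs → (c ⊕ xs) ! i ≡ c + xs ! i
!-⊕ c (x ∷ xs) {zero} _ = refl
!-⊕ c (x ∷ xs) {suc i} (s≤s i<n) = !-⊕ c xs i<n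

!-take : ∀ n xs {i} → i < n → take n xs ! i ≡ xs ! i
!-take (suc n) [] _ = refl
!-take (suc n) (x ∷ xs) {zero} _ = refl
!-take (suc n) (x ∷ xs) {suc i} (s≤s i<n) = !-take n xs i<n

!-drop : ∀ n xs i → drop n xs ! i ≡ xs ! (n + i)
!-drop zero xs i = refl
!-drop (suc n) [] i = refl
!-drop (suc n) (x ∷ xs) i = !-drop n xs i

!-reverse : ∀ xs i j → suc (i + j) ≡ length xs → reverse xs ! i ≡ xs ! j
!-reverse (x ∷ xs) i zero eq = begin
  reverse (x ∷ xs) ! i                      ≡⟨ cong (_! i) (unfold-reverse x xs) ⟩
  (reverse xs ∷ʳ x) ! i                     ≡⟨ cong ((reverse xs ∷ʳ x) !_) i≡ ⟩
  (reverse xs ∷ʳ x) ! (length (reverse xs) + 0) ≡⟨ !-++ʳ (reverse xs) [ x ] 0 ⟩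
  x                                         ∎
  where
  open ≡-Reasoning
  i≡ : i ≡ length (reverse xs) + 0
  i≡ = trans (sym (+-identityʳ i)) (trans (suc-injective eq) (sym (trans (+-identityʳ _) (length-reverse xs))))
!-reverse (x ∷ xs) i (suc j) eq = begin
  reverse (x ∷ xs) ! i   ≡⟨ cong (_! i) (unfold-reverse x xs) ⟩
  (reverse xs ∷ʳ x) ! i  ≡⟨ !-++ˡ (reverse xs) [ x ] i<n ⟩
  reverse xs ! i         ≡⟨ !-reverse xs i j eq′ ⟩
  xs ! j                 ∎
  where
  open ≡-Reasoning
  eq′ : suc (i + j) ≡ length xs
  eq′ = suc-injective (trans (cong suc (sym (+-suc i j))) eq)
  i<n : i < length (reverse xs)
  i<n = subst (i <_) (trans eq′ (sym (length-reverse xs))) (s≤s (m≤m+n i j))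

split-at : ∀ L i → i < L ⊎ Σ[ c ∈ ℕ ] L + c ≡ i
split-at L i with i <? L
... | yes i<L = inj₁ i<L
... | no i≮L = inj₂ (m≤n⇒∃[o]m+o≡n (≮⇒≥ i≮L))

reverse-++-∷ : ∀ xs (x : ℕ) ys → reverse (xs ++ x ∷ ys) ≡ reverse ys ++ x ∷ reverse xs
reverse-++-∷ xs x ys = begin
  reverse (xs ++ x ∷ ys)              ≡⟨ reverse-++ xs (x ∷ ys) ⟩
  reverse (x ∷ ys) ++ reverse xs      ≡⟨ cong (_++ reverse xs) (unfold-reverse x ys) ⟩
  (reverse ys ∷ʳ x) ++ reverse xs     ≡⟨ ++-assoc (reverse ys) [ x ] (reverse xs) ⟩
  reverse ys ++ x ∷ reverse xs        ∎
  where open ≡-Reasoning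

palindrome-⊕ : ∀ c w → IsPalindrome w → IsPalindrome (c ⊕ w)
palindrome-⊕ c w pal = trans (sym (reverse-map (c +_) w)) (cong (c ⊕_) pal)

palindrome-! : ∀ xs → IsPalindrome xs → ∀ i j → suc (i + j) ≡ length xs → xs ! i ≡ xs ! j
palindrome-! xs pal i j eq = trans (cong (_! i) (sym pal)) (!-reverse xs i j eq)

MirrorSymmetric : Word → ℕ → ℕ → Set
MirrorSymmetric w a b = ∀ p q → a ≤ p → a ≤ q → p + q ≡ a + b → w ! p ≡ w ! q

mirror-≤ : ∀ {a b p q} → a ≤ q → p + q ≡ a + b → p ≤ b
mirror-≤ {a} {b} {p} {q} a≤q eq =
  +-cancelʳ-≤ q p b (subst (_≤ b + q) (sym eq) (subst (a + b ≤_) (+-comm q b) (+-monoˡ-≤ b a≤q)))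

length-take-drop : ∀ a l (w : Word) → a + l ≤ length w → length (take l (drop a w)) ≡ l
length-take-drop a l w a+l≤n = begin
  length (take l (drop a w))      ≡⟨ length-take l (drop a w) ⟩
  l ⊓ length (drop a w)           ≡⟨ cong (l ⊓_) (length-drop a w) ⟩
  l ⊓ (length w ∸ a)              ≡⟨ m≤n⇒m⊓n≡m (m+n≤o⇒m≤o∸n l (subst (_≤ length w) (+-comm a l) a+l≤n)) ⟩
  l                               ∎
  where open ≡-Reasoning

palindrome⇒mirror-symmetric : ∀ w a b → b < length w → IsPalindrome (factor w (suc a) (suc b)) →
  MirrorSymmetric w a b
palindrome⇒mirror-symmetric w a b b<n pal p q a≤p a≤q eq
  with i , refl ← m≤n⇒∃[o]m+o≡n a≤p | j , refl ← m≤n⇒∃[o]m+o≡n a≤q = begin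
  w ! (a + i)  ≡⟨ sym (!-factor i (s≤s (m≤m+n i j))) ⟩
  f ! i        ≡⟨ palindrome-! f pal i j (sym (trans (length-take-drop a l w a+l≤n) l≡)) ⟩
  f ! j        ≡⟨ !-factor j (s≤s (m≤n+m j i)) ⟩
  w ! (a + j)  ∎
  where
  open ≡-Reasoning
  l = suc b ∸ a
  f = factor w (suc a) (suc b)
  a+ij≡b : a + suc (i + j) ≡ suc b
  a+ij≡b = trans (+-suc a (i + j)) (cong suc (+-cancelˡ-≡ a _ _ (trans (shuffle a i j) eq)))
    where
    shuffle : ∀ a i j → a + (a + (i + j)) ≡ a + i + (a + j)
    shuffle = solve-∀
  l≡ : l ≡ suc (i + j)
  l≡ = trans (cong (_∸ a) (sym a+ij≡b)) (m+n∸m≡n a (suc (i + j)))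
  a+l≤n : a + l ≤ length w
  a+l≤n = subst (_≤ length w) (sym (trans (cong (a +_) l≡) a+ij≡b)) b<n
  !-factor : ∀ u → u < suc (i + j) → f ! u ≡ w ! (a + u)
  !-factor u u<l = trans (!-take l (drop a w) (subst (u <_) (sym l≡) u<l)) (!-drop a w u)

PalindromicPrefix : Word → ℕ → Set
PalindromicPrefix w ℓ = ∀ u v → suc (u + v) ≡ ℓ → w ! u ≡ w ! v

PalindromicPrefix-common : ∀ P A B ℓ → ℓ ≤ length P →
  PalindromicPrefix (P ++ A) ℓ → PalindromicPrefix (P ++ B) ℓ
PalindromicPrefix-common P A B ℓ ℓ≤n pal u v eq = begin
  (P ++ B) ! u  ≡⟨ !-++ˡ P B u<n ⟩
  P ! u         ≡⟨ !-++ˡ P A u<n ⟨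
  (P ++ A) ! u  ≡⟨ pal u v eq ⟩
  (P ++ A) ! v  ≡⟨ !-++ˡ P A v<n ⟩
  P ! v         ≡⟨ !-++ˡ P B v<n ⟨
  (P ++ B) ! v  ∎
  where
  open ≡-Reasoning
  u<n = <-≤-trans (subst (u <_) eq (s≤s (m≤m+n u v))) ℓ≤n
  v<n = <-≤-trans (subst (v <_) eq (s≤s (m≤n+m v u))) ℓ≤n

UniquePalindromicPrefixBefore : ℕ → ℕ → Word → Set
UniquePalindromicPrefixBefore m ℓ₀ w =
  ∀ ℓ → ℓ < length w → PalindromicPrefix w ℓ → w ! ℓ ≡ m → ℓ ≡ ℓ₀

infix 4 _≼_

_≼_ : Word → Word → Set
p ≼ w = Σ[ r ∈ Word ] w ≡ p ++ r

≼-trans : ∀ {p q w} → p ≼ q → q ≼ w → p ≼ w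
≼-trans {p} (r , refl) (r′ , refl) = r ++ r′ , ++-assoc p r r′

≼-length : ∀ {p w} → p ≼ w → length p ≤ length w
≼-length {p} (r , refl) = length-++-≤ˡ p

take-≼ : ∀ {p w} → p ≼ w → take (length p) w ≡ p
take-≼ {[]} (r , refl) = refl
take-≼ {x ∷ p} (r , refl) = cong (x ∷_) (take-≼ (r , refl))

drop-length-++ : ∀ (xs ys : Word) n → drop (length xs + n) (xs ++ ys) ≡ drop n ys
drop-length-++ [] ys n = refl
drop-length-++ (x ∷ xs) ys n = drop-length-++ xs ys n

factor-take-drop : ∀ w p l → factor w (suc p) (p + l) ≡ take l (drop p w)
factor-take-drop w p l = cong (λ n → take n (drop p w)) (m+n∸m≡n p l)

dropLast-∷ʳ : ∀ xs (x : ℕ) → dropLast (xs ∷ʳ x) ≡ xs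
dropLast-∷ʳ [] x = refl
dropLast-∷ʳ (y ∷ []) x = refl
dropLast-∷ʳ (y ∷ y′ ∷ xs) x = cong (y ∷_) (dropLast-∷ʳ (y′ ∷ xs) x)

φ-++ : ∀ k xs ys → φ k (xs ++ ys) ≡ φ k xs ++ φ k ys
φ-++ k = concatMap-++ (φLetter k)

φ-[_] : ∀ {k} a → φ k [ a ] ≡ φLetter k a
φ-[ a ] = ++-identityʳ _

φLetter-< : ∀ κ a → a < κ → φLetter (suc κ) a ≡ 0 ∷ suc a ∷ []
φLetter-< κ a a<κ rewrite m<n⇒m%n≡m (m<n⇒m<1+n a<κ) with a ≡ᵇ κ in eq
... | true = contradiction (≡ᵇ⇒≡ a κ (subst T (sym eq) tt)) (<⇒≢ a<κ)
... | false = cong₂ _∷_ (n∸n≡0 a) (cong [_] (+-comm a 1))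

φLetter-top : ∀ κ → φLetter (suc κ) κ ≡ [ suc κ ]
φLetter-top κ rewrite m<n⇒m%n≡m (n<1+n κ) with κ ≡ᵇ κ in eq
... | true = cong [_] (+-comm κ 1)
... | false = contradiction (subst T eq (≡⇒≡ᵇ κ κ refl)) λ ()

[k+a]%k≡a%k : ∀ κ a → (suc κ + a) % suc κ ≡ a % suc κ
[k+a]%k≡a%k κ a = trans (cong (_% suc κ) (+-comm (suc κ) a)) ([m+n]%n≡m%n a (suc κ))

φLetter-shift : ∀ κ a → φLetter (suc κ) (suc κ + a) ≡ suc κ ⊕ φLetter (suc κ) a
φLetter-shift κ a rewrite [k+a]%k≡a%k κ a with a % suc κ ≡ᵇ κ
... | true = cong [_] (+-assoc (suc κ) a 1)
... | false = cong₂ _∷_ (+-∸-assoc (suc κ) (m%n≤m a (suc κ))) (cong [_] (+-assoc (suc κ) a 1))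

φ-⊕ : ∀ κ w → φ (suc κ) (suc κ ⊕ w) ≡ suc κ ⊕ φ (suc κ) w
φ-⊕ κ [] = refl
φ-⊕ κ (a ∷ w) = begin
  φLetter (suc κ) (suc κ + a) ++ φ (suc κ) (suc κ ⊕ w)  ≡⟨ cong₂ _++_ (φLetter-shift κ a) (φ-⊕ κ w) ⟩
  (suc κ ⊕ φLetter (suc κ) a) ++ (suc κ ⊕ φ (suc κ) w)  ≡⟨ map-++ (suc κ +_) (φLetter (suc κ) a) _ ⟨
  suc κ ⊕ φ (suc κ) (a ∷ w)                              ∎
  where open ≡-Reasoning

ZeroBeforeSmall : ℕ → Word → Set
ZeroBeforeSmall k [] = ⊤
ZeroBeforeSmall k (x ∷ []) = ⊤
ZeroBeforeSmall k (x ∷ y ∷ xs) = (1 ≤ y → y < k → x ≡ 0) × ZeroBeforeSmall k (y ∷ xs)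

HeadNotSmall : ℕ → Word → Set
HeadNotSmall k [] = ⊤
HeadNotSmall k (y ∷ _) = y ≡ 0 ⊎ k ≤ y

ZeroBeforeSmall-++ : ∀ k xs ys → ZeroBeforeSmall k xs → ZeroBeforeSmall k ys → HeadNotSmall k ys →
  ZeroBeforeSmall k (xs ++ ys)
ZeroBeforeSmall-++ k [] ys _ zys _ = zys
ZeroBeforeSmall-++ k (x ∷ []) [] _ _ _ = tt
ZeroBeforeSmall-++ k (x ∷ []) (y ∷ ys) _ zys (inj₁ refl) = (λ ()) , zys
ZeroBeforeSmall-++ k (x ∷ []) (y ∷ ys) _ zys (inj₂ k≤y) = (λ _ y<k → contradiction k≤y (<⇒≱ y<k)) , zys
ZeroBeforeSmall-++ k (x ∷ x′ ∷ xs) ys (z , zxs) zys hys = z , ZeroBeforeSmall-++ k (x′ ∷ xs) ys zxs zys hys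

HeadNotSmall-++ : ∀ k xs ys → HeadNotSmall k xs → HeadNotSmall k ys → HeadNotSmall k (xs ++ ys)
HeadNotSmall-++ k [] ys _ hys = hys
HeadNotSmall-++ k (x ∷ xs) ys hxs _ = hxs

zero-before-small : ∀ k w i → ZeroBeforeSmall k w → suc i < length w →
  1 ≤ w ! suc i → w ! suc i < k → w ! i ≡ 0
zero-before-small k (x ∷ y ∷ xs) zero (z , _) _ = z
zero-before-small k (x ∷ y ∷ xs) (suc i) (_ , zw) (s≤s i<n) = zero-before-small k (y ∷ xs) i zw i<n

multiple-not-small : ∀ κ q → q * suc κ ≡ 0 ⊎ suc κ ≤ q * suc κ
multiple-not-small κ zero = inj₁ refl
multiple-not-small κ (suc q) = inj₂ (m≤m+n (suc κ) (q * suc κ))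

φLetter-ZeroBeforeSmall : ∀ κ a →
  ZeroBeforeSmall (suc κ) (φLetter (suc κ) a) × HeadNotSmall (suc κ) (φLetter (suc κ) a)
φLetter-ZeroBeforeSmall κ a with a % suc κ ≡ᵇ κ in eq
... | true = tt , inj₂ (subst (λ r → suc r ≤ a + 1) (≡ᵇ⇒≡ _ κ (subst T (sym eq) tt))
                       (subst (suc (a % suc κ) ≤_) (+-comm 1 a) (s≤s (m%n≤m a (suc κ)))))
... | false = ((λ _ a+1<k → block-start-zero (m<n⇒m%n≡m (<-trans (n<1+n a) (subst (_< suc κ) (+-comm a 1) a+1<k))))
               , tt)
            , subst (λ x → x ≡ 0 ⊎ suc κ ≤ x) (sym block-start) (multiple-not-small κ (a / suc κ))
  where
  block-start : a ∸ a % suc κ ≡ (a / suc κ) * suc κ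
  block-start = trans (cong (_∸ a % suc κ) (m≡m%n+[m/n]*n a (suc κ))) (m+n∸m≡n (a % suc κ) _)
  block-start-zero : a % suc κ ≡ a → a ∸ a % suc κ ≡ 0
  block-start-zero r≡a = trans (cong (a ∸_) r≡a) (n∸n≡0 a)

φ-ZeroBeforeSmall : ∀ κ w →
  ZeroBeforeSmall (suc κ) (φ (suc κ) w) × HeadNotSmall (suc κ) (φ (suc κ) w)
φ-ZeroBeforeSmall κ [] = tt , tt
φ-ZeroBeforeSmall κ (a ∷ w) =
  ZeroBeforeSmall-++ (suc κ) (φLetter (suc κ) a) (φ (suc κ) w) zl zw hw ,
  HeadNotSmall-++ (suc κ) (φLetter (suc κ) a) (φ (suc κ) w) hl hw
  where
  zl = proj₁ (φLetter-ZeroBeforeSmall κ a)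
  hl = proj₂ (φLetter-ZeroBeforeSmall κ a)
  zw = proj₁ (φ-ZeroBeforeSmall κ w)
  hw = proj₂ (φ-ZeroBeforeSmall κ w)

W-ZeroBeforeSmall : ∀ κ n → ZeroBeforeSmall (suc κ) (W (suc κ) (suc n))
W-ZeroBeforeSmall κ n = proj₁ (φ-ZeroBeforeSmall κ (W (suc κ) n))

-- Zimin words

zimin : ℕ → Word
zimin zero = []
zimin (suc j) = zimin j ++ j ∷ zimin j

zimin-palindrome : ∀ j → IsPalindrome (zimin j)
zimin-palindrome zero = refl
zimin-palindrome (suc j) =
  trans (reverse-++-∷ (zimin j) j (zimin j)) (cong (λ z → z ++ j ∷ z) (zimin-palindrome j))

length-zimin-suc : ∀ j → length (zimin (suc j)) ≡ length (zimin j) + suc (length (zimin j))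
length-zimin-suc j = length-++ (zimin j)

zimin-nonempty : ∀ j → 0 < length (zimin (suc j))
zimin-nonempty j = subst (0 <_) (sym (length-zimin-suc j)) (≤-trans (s≤s z≤n) (m≤n+m _ (length (zimin j))))

zimin-suc-offset-< : ∀ j c → length (zimin j) + suc c < length (zimin (suc j)) → c < length (zimin j)
zimin-suc-offset-< j c lt =
  s≤s⁻¹ (+-cancelˡ-< (length (zimin j)) (suc c) _ (subst (length (zimin j) + suc c <_) (length-zimin-suc j) lt))

zimin-< : ∀ j i → i < length (zimin j) → zimin j ! i < j
zimin-< (suc j) i i<n with split-at (length (zimin j)) i
... | inj₁ i<L = subst (_< suc j) (sym (!-++ˡ (zimin j) _ i<L)) (m<n⇒m<1+n (zimin-< j i i<L))
... | inj₂ (zero , refl) = subst (_< suc j) (sym (!-++ʳ (zimin j) _ 0)) ≤-refl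
... | inj₂ (suc c , refl) = subst (_< suc j) (sym (!-++ʳ (zimin j) _ (suc c))) (m<n⇒m<1+n (zimin-< j c c<L))
  where c<L = zimin-suc-offset-< j c i<n

zimin-palindromic-prefix : ∀ j m → UniquePalindromicPrefixBefore m (length (zimin m)) (zimin j)
zimin-palindromic-prefix (suc j) m ℓ ℓ<n pal ℓ↦m with split-at (length (zimin j)) ℓ
... | inj₁ ℓ<L = zimin-palindromic-prefix j m ℓ ℓ<L
                   (subst (λ x → PalindromicPrefix x ℓ) (++-identityʳ (zimin j))
                     (PalindromicPrefix-common (zimin j) _ [] ℓ (<⇒≤ ℓ<L) pal))
                   (trans (sym (!-++ˡ (zimin j) _ ℓ<L)) ℓ↦m)
... | inj₂ (zero , refl) =
  trans (+-identityʳ _) (cong (λ x → length (zimin x)) (trans (sym (!-++ʳ (zimin j) _ 0)) ℓ↦m))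
... | inj₂ (suc c , refl) = contradiction mirror (<⇒≢ (zimin-< j c c<L))
  where
  c<L = zimin-suc-offset-< j c ℓ<n
  mirror : zimin j ! c ≡ j
  mirror = sym (begin
    j                                    ≡⟨ !-++ʳ (zimin j) (j ∷ zimin j) 0 ⟨
    zimin (suc j) ! (length (zimin j) + 0) ≡⟨ pal _ c (trans (cong (λ x → suc (x + c)) (+-identityʳ _))
                                                         (sym (+-suc _ c))) ⟩
    zimin (suc j) ! c                    ≡⟨ !-++ˡ (zimin j) _ c<L ⟩
    zimin j ! c                          ∎)
    where open ≡-Reasoning

zimin-≼ : ∀ j d → zimin j ≼ zimin (j + d)
zimin-≼ j zero = [] , trans (cong zimin (+-identityʳ j)) (sym (++-identityʳ (zimin j)))
zimin-≼ j (suc d) rewrite +-suc j d = ≼-trans (zimin-≼ j d) (_ , refl)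

zimin-last-two : ∀ j → Σ[ G ∈ Word ] zimin (suc (suc j)) ≡ G ++ 1 ∷ 0 ∷ []
zimin-last-two zero = [ 0 ] , refl
zimin-last-two (suc j) with G , eq ← zimin-last-two j =
  zimin (suc (suc j)) ++ suc (suc j) ∷ G ,
  trans (cong (λ z → zimin (suc (suc j)) ++ suc (suc j) ∷ z) eq)
        (sym (++-assoc (zimin (suc (suc j))) (suc (suc j) ∷ G) _))

φ-zimin : ∀ κ j → j ≤ κ → φ (suc κ) (zimin j) ∷ʳ 0 ≡ zimin (suc j)
φ-zimin κ zero _ = refl
φ-zimin κ (suc j) j<κ = begin
  φ k (Z ++ j ∷ Z) ∷ʳ 0                      ≡⟨ cong (_∷ʳ 0) (φ-++ k Z (j ∷ Z)) ⟩
  (φ k Z ++ φLetter k j ++ φ k Z) ∷ʳ 0       ≡⟨ cong (λ x → (φ k Z ++ x ++ φ k Z) ∷ʳ 0) (φLetter-< κ j j<κ) ⟩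
  (φ k Z ++ 0 ∷ suc j ∷ φ k Z) ∷ʳ 0          ≡⟨ ++-assoc (φ k Z) _ [ 0 ] ⟩
  φ k Z ++ 0 ∷ suc j ∷ (φ k Z ∷ʳ 0)          ≡⟨ ++-assoc (φ k Z) [ 0 ] _ ⟨
  (φ k Z ∷ʳ 0) ++ suc j ∷ (φ k Z ∷ʳ 0)       ≡⟨ cong (λ x → x ++ suc j ∷ x) (φ-zimin κ j (<⇒≤ j<κ)) ⟩
  zimin (suc (suc j))                        ∎
  where
  open ≡-Reasoning
  k = suc κ
  Z = zimin j

W-zimin : ∀ κ j → j ≤ κ → W (suc κ) j ≡ zimin j ∷ʳ j
W-zimin κ zero _ = refl
W-zimin κ (suc j) j<κ = begin
  φ k (W k j)                      ≡⟨ cong (φ k) (W-zimin κ j (<⇒≤ j<κ)) ⟩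
  φ k (zimin j ∷ʳ j)               ≡⟨ φ-++ k (zimin j) [ j ] ⟩
  φ k (zimin j) ++ φ k [ j ]       ≡⟨ cong (φ k (zimin j) ++_) (trans φ-[ j ] (φLetter-< κ j j<κ)) ⟩
  φ k (zimin j) ++ 0 ∷ suc j ∷ []  ≡⟨ ++-assoc (φ k (zimin j)) [ 0 ] [ suc j ] ⟨
  (φ k (zimin j) ∷ʳ 0) ∷ʳ suc j    ≡⟨ cong (_∷ʳ suc j) (φ-zimin κ j (<⇒≤ j<κ)) ⟩
  zimin (suc j) ∷ʳ suc j           ∎
  where
  open ≡-Reasoning
  k = suc κ

W-≼ : ∀ κ j x → W (suc (suc κ)) j ≼ W (suc (suc κ)) (j + x)
W-≼ κ zero zero = [] , refl
W-≼ κ zero (suc x) with r , eq ← W-≼ κ zero x =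
  1 ∷ φ k r , trans (cong (φ k) eq) (cong (_++ φ k r) (φLetter-< (suc κ) 0 (s≤s z≤n)))
  where k = suc (suc κ)
W-≼ κ (suc j) x with r , eq ← W-≼ κ j x =
  φ k r , trans (cong (φ k) eq) (φ-++ k (W k j) r)
  where k = suc (suc κ)

zimin-≼-W : ∀ j m x → m ≤ suc j → zimin m ≼ W (suc (suc j)) (suc (suc j) + x)
zimin-≼-W j m x m≤κ =
  ≼-trans (subst (λ l → zimin m ≼ zimin l) (proj₂ (m≤n⇒∃[o]m+o≡n m≤κ)) (zimin-≼ m _))
    (≼-trans ([ suc j ] , W-zimin (suc j) (suc j) ≤-refl)
      (subst (λ l → W k (suc j) ≼ W k l) (+-suc (suc j) x) (W-≼ j (suc j) (suc x))))
  where k = suc (suc j)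

blocks : ℕ → ℕ → ℕ → Word
blocks k a zero = []
blocks k a (suc j) = blocks k (suc a) j ++ W k a

φ-blocks : ∀ k a j → φ k (blocks k a j) ≡ blocks k (suc a) j
φ-blocks k a zero = refl
φ-blocks k a (suc j) = trans (φ-++ k (blocks k (suc a) j) (W k a)) (cong (_++ W k (suc a)) (φ-blocks k (suc a) j))

sum-applyUpTo-cong : ∀ (f g : ℕ → ℕ) j → (∀ i → f i ≡ g i) → sum (applyUpTo f j) ≡ sum (applyUpTo g j)
sum-applyUpTo-cong f g zero f≗g = refl
sum-applyUpTo-cong f g (suc j) f≗g =
  cong₂ _+_ (f≗g 0) (sum-applyUpTo-cong (λ i → f (suc i)) (λ i → g (suc i)) j (λ i → f≗g (suc i)))

length-blocks : ∀ k a j → length (blocks k a j) ≡ sum (applyUpTo (λ i → length (W k (a + i))) j)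
length-blocks k a zero = refl
length-blocks k a (suc j) = begin
  length (blocks k (suc a) j ++ W k a)          ≡⟨ length-++ (blocks k (suc a) j) ⟩
  length (blocks k (suc a) j) + length (W k a)  ≡⟨ +-comm _ (length (W k a)) ⟩
  length (W k a) + length (blocks k (suc a) j)  ≡⟨ cong₂ _+_ (cong (λ x → length (W k x)) (sym (+-identityʳ a)))
                                                             (length-blocks k (suc a) j) ⟩
  length (W k (a + 0)) + sum (applyUpTo (λ i → length (W k (suc a + i))) j)
    ≡⟨ cong (length (W k (a + 0)) +_) (sum-applyUpTo-cong _ _ j (λ i → cong (λ x → length (W k x)) (sym (+-suc a i)))) ⟩
  sum (applyUpTo (λ i → length (W k (a + i))) (suc j))  ∎
  where open ≡-Reasoning

zimin-blocks : ∀ κ j → j ≤ suc κ → zimin j ≡ blocks (suc κ) 0 j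
zimin-blocks κ zero _ = refl
zimin-blocks κ (suc j) j≤κ = begin
  zimin (suc j)                          ≡⟨ φ-zimin κ j (s≤s⁻¹ j≤κ) ⟨
  φ (suc κ) (zimin j) ∷ʳ 0               ≡⟨ cong (λ x → φ (suc κ) x ∷ʳ 0) (zimin-blocks κ j (<⇒≤ j≤κ)) ⟩
  φ (suc κ) (blocks (suc κ) 0 j) ∷ʳ 0    ≡⟨ cong (_∷ʳ 0) (φ-blocks (suc κ) 0 j) ⟩
  blocks (suc κ) 0 (suc j)               ∎
  where open ≡-Reasoning

W-top : ∀ κ → W (suc κ) (suc κ) ≡ φ (suc κ) (zimin κ) ∷ʳ suc κ
W-top κ = begin
  φ k (W k κ)                 ≡⟨ cong (φ k) (W-zimin κ κ ≤-refl) ⟩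
  φ k (zimin κ ∷ʳ κ)          ≡⟨ φ-++ k (zimin κ) [ κ ] ⟩
  φ k (zimin κ) ++ φ k [ κ ]  ≡⟨ cong (φ k (zimin κ) ++_) (trans φ-[ κ ] (φLetter-top κ)) ⟩
  φ k (zimin κ) ∷ʳ k          ∎
  where
  open ≡-Reasoning
  k = suc κ

W-decomposition : ∀ κ d → W (suc κ) (suc κ + d) ≡ blocks (suc κ) (suc d) κ ++ suc κ ⊕ W (suc κ) d
W-decomposition κ zero rewrite +-identityʳ κ = begin
  W k k                        ≡⟨ W-top κ ⟩
  φ k (zimin κ) ∷ʳ k           ≡⟨ cong (λ x → φ k x ∷ʳ k) (zimin-blocks κ κ (n≤1+n κ)) ⟩
  φ k (blocks k 0 κ) ∷ʳ k      ≡⟨ cong (_∷ʳ k) (φ-blocks k 0 κ) ⟩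
  blocks k 1 κ ∷ʳ k            ∎
  where
  open ≡-Reasoning
  k = suc κ
W-decomposition κ (suc d) rewrite +-suc κ d = begin
  φ k (W k (suc κ + d))                          ≡⟨ cong (φ k) (W-decomposition κ d) ⟩
  φ k (blocks k (suc d) κ ++ k ⊕ W k d)          ≡⟨ φ-++ k (blocks k (suc d) κ) (k ⊕ W k d) ⟩
  φ k (blocks k (suc d) κ) ++ φ k (k ⊕ W k d)    ≡⟨ cong₂ _++_ (φ-blocks k (suc d) κ) (φ-⊕ κ (W k d)) ⟩
  blocks k (suc (suc d)) κ ++ k ⊕ W k (suc d)    ∎
  where
  open ≡-Reasoning
  k = suc κ

e-blocks : ∀ κ d → e (suc κ) (suc κ + d) ≡ length (blocks (suc κ) (suc d) κ)
e-blocks κ d = trans (cong (λ a → sum (applyUpTo (λ i → length (W (suc κ) (a + i))) κ)) start)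
                     (sym (length-blocks (suc κ) (suc d) κ))
  where
  start : suc κ + d + 1 ∸ suc κ ≡ suc d
  start = trans (cong (_∸ suc κ) (trans (+-assoc (suc κ) d 1) (cong (suc κ +_) (+-comm d 1))))
                (m+n∸m≡n (suc κ) (suc d))

module _ (k : ℕ) (G R : Word) where
  private
    P V : Word
    P = G ∷ʳ 1
    V = P ++ k ∷ R

    length-P : length P ≡ suc (length G)
    length-P = trans (length-++ G) (+-comm (length G) 1)

    V-at-P : V ! (length P + 0) ≡ k
    V-at-P = !-++ʳ P (k ∷ R) 0

    V-at-G : V ! (length G + 0) ≡ 1
    V-at-G = begin
      V ! (length G + 0)  ≡⟨ !-++ˡ P (k ∷ R) (subst (_< length P) (sym (+-identityʳ _)) G<P) ⟩
      P ! (length G + 0)  ≡⟨ !-++ʳ G [ 1 ] 0 ⟩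
      1                   ∎
      where
      open ≡-Reasoning
      G<P : length G < length P
      G<P = subst (length G <_) (sym length-P) ≤-refl

  palindromic-prefix-beside-zimin : zimin k ≡ P ∷ʳ 0 → ZeroBeforeSmall k V →
    ∀ m → suc m < k → UniquePalindromicPrefixBefore m (length (zimin m)) V
  palindromic-prefix-beside-zimin zimin-k zbs m m<k ℓ ℓ<n pal ℓ↦m with split-at (length P) ℓ
  ... | inj₁ ℓ<P = zimin-palindromic-prefix k m ℓ ℓ<Z
                     (subst (λ x → PalindromicPrefix x ℓ) (sym zimin-k)
                       (PalindromicPrefix-common P (k ∷ R) [ 0 ] ℓ (<⇒≤ ℓ<P) pal))
                     (begin
                       zimin k ! ℓ  ≡⟨ cong (_! ℓ) zimin-k ⟩
                       (P ∷ʳ 0) ! ℓ ≡⟨ !-++ˡ P [ 0 ] ℓ<P ⟩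
                       P ! ℓ        ≡⟨ !-++ˡ P (k ∷ R) ℓ<P ⟨
                       V ! ℓ        ≡⟨ ℓ↦m ⟩
                       m            ∎)
    where
    open ≡-Reasoning
    ℓ<Z : ℓ < length (zimin k)
    ℓ<Z = subst (ℓ <_) (sym (trans (cong length zimin-k) (length-++ P))) (m≤n⇒m≤n+o 1 ℓ<P)
  ... | inj₂ (zero , refl) = contradiction (trans (sym V-at-P) ℓ↦m) (>⇒≢ (<-trans (n<1+n m) m<k))
  -- Beyond P, the mirror images of the letters 1 and k at positions |G| and |P| would put a 1 right after a k.
  ... | inj₂ (suc d , refl) = contradiction (trans (sym k-at-d) 0-at-d) (>⇒≢ (<-trans (s≤s z≤n) m<k))
    where
    k-at-d : V ! d ≡ k
    k-at-d = trans (sym (pal (length P + 0) d (trans (cong (λ x → suc (x + d)) (+-identityʳ _)) (sym (+-suc _ d)))))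
                   V-at-P
    1-at-d+1 : V ! suc d ≡ 1
    1-at-d+1 = trans (sym (pal (length G + 0) (suc d) (cong (_+ suc d) (trans (cong suc (+-identityʳ _)) (sym length-P)))))
                     V-at-G
    0-at-d : V ! d ≡ 0
    0-at-d = zero-before-small k V d zbs (≤-<-trans (m≤n+m (suc d) (length P)) ℓ<n)
               (subst (1 ≤_) (sym 1-at-d+1) ≤-refl) (subst (_< k) (sym 1-at-d+1) (<-≤-trans (s≤s (s≤s z≤n)) m<k))

W-top-beside-zimin : ∀ j → let k = suc (suc j) in
  Σ[ G ∈ Word ] W k k ≡ (G ∷ʳ 1) ∷ʳ k × zimin k ≡ (G ∷ʳ 1) ∷ʳ 0
W-top-beside-zimin j with G , zimin-k ← zimin-last-two j =
  G , trans (W-top (suc j)) (cong (_∷ʳ k) φ-zimin-κ) , zimin-k′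
  where
  k = suc (suc j)
  zimin-k′ : zimin k ≡ (G ∷ʳ 1) ∷ʳ 0
  zimin-k′ = trans zimin-k (sym (++-assoc G [ 1 ] [ 0 ]))
  φ-zimin-κ : φ k (zimin (suc j)) ≡ G ∷ʳ 1
  φ-zimin-κ = ∷ʳ-injectiveˡ _ _ (trans (φ-zimin (suc j) (suc j) ≤-refl) zimin-k′)

W-palindromic-prefix : ∀ j x m → let k = suc (suc j) in
  suc m < k → UniquePalindromicPrefixBefore m (length (zimin m)) (W k (k + x))
W-palindromic-prefix j x m m<k
  with G , W-k , zimin-k ← W-top-beside-zimin j | R , W-k≼ ← W-≼ j (suc (suc j)) x =
  subst (UniquePalindromicPrefixBefore m (length (zimin m))) (sym V-shape)
    (palindromic-prefix-beside-zimin k G R zimin-k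
      (subst (ZeroBeforeSmall k) V-shape (W-ZeroBeforeSmall (suc j) (suc j + x))) m m<k)
  where
  k = suc (suc j)
  V-shape : W k (k + x) ≡ (G ∷ʳ 1) ++ k ∷ R
  V-shape = trans W-k≼ (trans (cong (_++ R) W-k) (++-assoc (G ∷ʳ 1) [ k ] R))

-- Straddling palindromes

module _ (m : ℕ) (U V : Word) where
  private
    L = length U
    Y = U ++ m ∷ V

    Y-at-L : Y ! (L + 0) ≡ m
    Y-at-L = !-++ʳ U (m ∷ V) 0

    mirror-of-centre : ∀ {a b} q → MirrorSymmetric Y a b → a ≤ L → L ≤ b → L + q ≡ a + b → Y ! q ≡ m
    mirror-of-centre {a} {b} q sym-ab a≤L L≤b L+q≡a+b =
      trans (sym (sym-ab (L + 0) q (subst (a ≤_) (sym (+-identityʳ L)) a≤L) a≤q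
                   (trans (cong (_+ q) (+-identityʳ L)) L+q≡a+b)))
            Y-at-L
      where
      a≤q : a ≤ q
      a≤q = +-cancelˡ-≤ L a q (subst (L + a ≤_) (sym L+q≡a+b) (subst (_≤ a + b) (+-comm a L) (+-monoʳ-≤ a L≤b)))

  centred-palindromes : (∀ i → i < L → U ! i < m) → UniquePalindromicPrefixBefore m L V →
    ∀ a b → a ≤ L → L < b → b < length Y → MirrorSymmetric Y a b →
    a + b ≡ L + L ⊎ a + b ≡ L + L + suc L
  centred-palindromes U<m V-unique a b a≤L L<b b<n sym-ab
    with q , L+q≡a+b ← m≤n⇒∃[o]m+o≡n (≤-trans (<⇒≤ L<b) (m≤n+m b a))
    with split-at L q
  ... | inj₁ q<L =
    contradiction (trans (sym (!-++ˡ U (m ∷ V) q<L)) (mirror-of-centre q sym-ab a≤L (<⇒≤ L<b) L+q≡a+b))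
                  (<⇒≢ (U<m q q<L))
  ... | inj₂ (zero , refl) = inj₁ (trans (sym L+q≡a+b) (cong (L +_) (+-identityʳ L)))
  ... | inj₂ (suc r , refl) =
    inj₂ (trans (sym L+q≡a+b) (trans (cong (λ x → L + (L + suc x)) r≡L) (sym (+-assoc L L (suc L)))))
    where
    r<V : r < length V
    r<V = s≤s⁻¹ (+-cancelˡ-< L (suc r) (suc (length V)) (subst (L + suc r <_) (length-++ U) (≤-<-trans q≤b b<n)))
      where
      q≤b : L + suc r ≤ b
      q≤b = +-cancelˡ-≤ L _ b (subst (_≤ L + b) (sym L+q≡a+b) (+-monoˡ-≤ b a≤L))
    V-pal : PalindromicPrefix V r
    V-pal u v eq = begin
      V ! u            ≡⟨ !-++ʳ U (m ∷ V) (suc u) ⟨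
      Y ! (L + suc u)  ≡⟨ sym-ab (L + suc u) (L + suc v) (≤-trans a≤L (m≤m+n L _)) (≤-trans a≤L (m≤m+n L _))
                           (trans (centre-sum L u v) (trans (cong (λ x → L + (L + suc x)) eq) L+q≡a+b)) ⟩
      Y ! (L + suc v)  ≡⟨ !-++ʳ U (m ∷ V) (suc v) ⟩
      V ! v            ∎
      where
      open ≡-Reasoning
      centre-sum : ∀ L u v → L + suc u + (L + suc v) ≡ L + (L + suc (suc (u + v)))
      centre-sum = solve-∀
    r≡L : r ≡ L
    r≡L = V-unique r r<V V-pal
            (trans (sym (!-++ʳ U (m ∷ V) (suc r))) (mirror-of-centre (L + suc r) sym-ab a≤L (<⇒≤ L<b) L+q≡a+b))

-- For w = W k n and E = e k n, Straddling k n, ABStraddling k n and Maximal k n are by definition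
-- StraddlingIn w E, ABStraddlingIn w E and MaximalIn (StraddlingIn w E).
StraddlingIn : Word → ℕ → ℕ → ℕ → Set
StraddlingIn w E s t = (1 ≤ s) × (s ≤ E) × (E < t) × (t ≤ length w) × IsPalindrome (factor w s t)

ABStraddlingIn : Word → ℕ → Word → Word → ℕ → ℕ → Set
ABStraddlingIn w E A B s t = StraddlingIn w E s t × (factor w s E ≡ A) × (factor w (suc E) t ≡ B)

MaximalIn : (ℕ → ℕ → Set) → ℕ → ℕ → Set
MaximalIn P s t = P s t × (∀ s′ t′ → P s′ t′ → s′ + t′ ≡ s + t → ¬ (t′ ∸ s′ > t ∸ s))

same-centre-not-longer : ∀ {s₀ t₀ s t} → s₀ ≤ s → s + t ≡ s₀ + t₀ → t ∸ s ≤ t₀ ∸ s₀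
same-centre-not-longer {s₀} {t₀} {s} {t} s₀≤s eq =
  ∸-mono (+-cancelˡ-≤ s₀ t t₀ (subst (s₀ + t ≤_) eq (+-monoˡ-≤ t s₀≤s))) s₀≤s

same-centre-longest : ∀ {s₀ t₀ s t} → s₀ ≤ s → s ≤ t → s + t ≡ s₀ + t₀ → ¬ (t₀ ∸ s₀ > t ∸ s) →
  s ≡ s₀ × t ≡ t₀
same-centre-longest {s₀} {t₀} s₀≤s s≤t eq not-shorter
  with p , refl ← m≤n⇒∃[o]m+o≡n s₀≤s | q , refl ← m≤n⇒∃[o]m+o≡n s≤t =
  offsets p q (+-cancelˡ-≡ s₀ t₀ _ (trans (sym eq) (shift s₀ p q))) not-shorter
  where
  shift : ∀ s₀ p q → s₀ + p + (s₀ + p + q) ≡ s₀ + (s₀ + (p + (p + q)))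
  shift = solve-∀
  offsets : ∀ p q {t₀} → t₀ ≡ s₀ + (p + (p + q)) → ¬ (t₀ ∸ s₀ > s₀ + p + q ∸ (s₀ + p)) →
    s₀ + p ≡ s₀ × s₀ + p + q ≡ t₀
  offsets zero q refl _ = +-identityʳ s₀ , cong (_+ q) (+-identityʳ s₀)
  offsets (suc p) q refl not-shorter = contradiction longer not-shorter
    where
    longer : s₀ + suc p + q ∸ (s₀ + suc p) < s₀ + (suc p + (suc p + q)) ∸ s₀
    longer = subst₂ _<_ (sym (m+n∸m≡n (s₀ + suc p) q)) (sym (m+n∸m≡n s₀ _))
               (subst (q <_) (+-assoc (suc p) (suc p) q) (m<n+m q (s≤s z≤n)))

maximal-two-centres : ∀ (P : ℕ → ℕ → Set) s₀ t₁ t₂ →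
  (∀ s t → P s t → s₀ ≤ s × s ≤ t × (s + t ≡ s₀ + t₁ ⊎ s + t ≡ s₀ + t₂)) →
  P s₀ t₁ → P s₀ t₂ →
  ∀ s t → MaximalIn P s t ⇔ ((s , t) ≡ (s₀ , t₁) ⊎ (s , t) ≡ (s₀ , t₂))
maximal-two-centres P s₀ t₁ t₂ classify P₁ P₂ s t = mk⇔ to from
  where
  leftmost-maximal : ∀ {t₀} → P s₀ t₀ → MaximalIn P s₀ t₀
  leftmost-maximal P₀ = P₀ , λ s′ t′ P′ eq → ≤⇒≯ (same-centre-not-longer (proj₁ (classify s′ t′ P′)) eq)
  longest : ∀ {t₀} → s₀ ≤ s → s ≤ t → s + t ≡ s₀ + t₀ → P s₀ t₀ → MaximalIn P s t → (s , t) ≡ (s₀ , t₀)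
  longest {t₀} s₀≤s s≤t eq P₀ (_ , maximal)
    with s≡ , t≡ ← same-centre-longest s₀≤s s≤t eq (maximal s₀ t₀ P₀ (sym eq)) = cong₂ _,_ s≡ t≡
  to : MaximalIn P s t → (s , t) ≡ (s₀ , t₁) ⊎ (s , t) ≡ (s₀ , t₂)
  to max with classify s t (proj₁ max)
  ... | s₀≤s , s≤t , inj₁ eq = inj₁ (longest s₀≤s s≤t eq P₁ max)
  ... | s₀≤s , s≤t , inj₂ eq = inj₂ (longest s₀≤s s≤t eq P₂ max)
  from : ∀ {s t} → (s , t) ≡ (s₀ , t₁) ⊎ (s , t) ≡ (s₀ , t₂) → MaximalIn P s t
  from (inj₁ refl) = leftmost-maximal P₁
  from (inj₂ refl) = leftmost-maximal P₂

TwoMaximalStraddling : ℕ → Word → ℕ → Word → Set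
TwoMaximalStraddling k w E Wm =
  Σ[ s₁ ∈ ℕ ] Σ[ t₁ ∈ ℕ ] Σ[ s₂ ∈ ℕ ] Σ[ t₂ ∈ ℕ ]
    ( ABStraddlingIn w E (k ⊕ Wm) (k ⊕ dropLast Wm) s₁ t₁
    × ABStraddlingIn w E (k ⊕ Wm) (k ⊕ dropLast (Wm ++ Wm)) s₂ t₂
    × (s₁ , t₁) ≢ (s₂ , t₂)
    × (∀ s t → MaximalIn (StraddlingIn w E) s t ⇔ ((s , t) ≡ (s₁ , t₁) ⊎ (s , t) ≡ (s₂ , t₂))) )

module Straddle (k m : ℕ) (X U V w : Word) (E : ℕ)
  (w-shape : w ≡ X ++ suc m ∷ k ⊕ (U ++ m ∷ V))
  (E-value : E ≡ suc (suc (length X + length U)))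
  (m+1<k : suc m < k)
  (w-ZeroBeforeSmall : ZeroBeforeSmall k w)
  (U-nonempty : 0 < length U)
  (U<m : ∀ i → i < length U → U ! i < m)
  (U-palindrome : IsPalindrome U)
  (UmU≼V : U ++ m ∷ U ≼ V)
  (V-unique : UniquePalindromicPrefixBefore m (length U) V)
  where

  -- Lookups are 0-based while factor and StraddlingIn are 1-based: o is the 0-based position of
  -- the first letter of k ⊕ U, c that of the letter k + m, and E = c + 1.

  o L : ℕ
  o = suc (length X)
  L = length U

  Y : Word
  Y = U ++ m ∷ V

  length-w : length w ≡ o + length Y
  length-w = trans (cong length w-shape)
    (trans (length-++ X) (trans (+-suc (length X) _) (cong (o +_) (length-map (k +_) Y))))

  w-at-X : w ! length X ≡ suc m
  w-at-X = trans (cong (_! length X) w-shape)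
             (trans (cong ((X ++ suc m ∷ k ⊕ Y) !_) (sym (+-identityʳ _))) (!-++ʳ X (suc m ∷ k ⊕ Y) 0))

  w-at-Y : ∀ i → i < length Y → w ! (o + i) ≡ k + Y ! i
  w-at-Y i i<Y = begin
    w ! (o + i)                        ≡⟨ cong₂ _!_ w-shape (sym (+-suc (length X) i)) ⟩
    (X ++ suc m ∷ k ⊕ Y) ! (length X + suc i) ≡⟨ !-++ʳ X (suc m ∷ k ⊕ Y) (suc i) ⟩
    (k ⊕ Y) ! i                        ≡⟨ !-⊕ k Y i<Y ⟩
    k + Y ! i                          ∎
    where open ≡-Reasoning

  c : ℕ
  c = o + L

  left-end-after-X : ∀ a b → MirrorSymmetric w a b → a ≤ c → c < b → b < length w → o ≤ a
  left-end-after-X a b sym-ab a≤c c<b b<n with length X <? a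
  ... | yes X<a = X<a
  ... | no X≮a with y , o+y≡a+b ← m≤n⇒∃[o]m+o≡n (≤-trans (≤-trans (m≤m+n o L) (<⇒≤ c<b)) (m≤n+m b a)) =
    contradiction (trans (sym 0-at-y) w-at-y) (<⇒≢ (<-≤-trans (<-trans (s≤s z≤n) m+1<k) (m≤m+n k _)))
    where
    a≤X : a ≤ length X
    a≤X = ≮⇒≥ X≮a
    o≤b : o ≤ b
    o≤b = ≤-trans (m≤m+n o L) (<⇒≤ c<b)
    a≤y : a ≤ y
    a≤y = +-cancelˡ-≤ o a y
            (subst (o + a ≤_) (sym o+y≡a+b) (subst (_≤ a + b) (+-comm a o) (+-monoʳ-≤ a o≤b)))
    X+y+1≡a+b : length X + suc y ≡ a + b
    X+y+1≡a+b = trans (+-suc (length X) y) o+y≡a+b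
    w-at-y : w ! y ≡ k + Y ! 0
    w-at-y = trans (sym (sym-ab (o + 0) y (≤-trans a≤X (≤-trans (n≤1+n _) (m≤m+n o 0))) a≤y
                          (trans (cong (_+ y) (+-identityʳ o)) o+y≡a+b)))
                   (w-at-Y 0 (subst (0 <_) (sym (trans (length-++ U) (+-suc L _))) (s≤s z≤n)))
    w-at-y+1 : w ! suc y ≡ suc m
    w-at-y+1 = trans (sym (sym-ab (length X) (suc y) a≤X (≤-trans a≤y (n≤1+n y)) X+y+1≡a+b)) w-at-X
    0-at-y : w ! y ≡ 0
    0-at-y = zero-before-small k w y w-ZeroBeforeSmall
               (≤-<-trans (mirror-≤ a≤X (trans (+-comm (suc y) (length X)) X+y+1≡a+b)) b<n)
               (subst (1 ≤_) (sym w-at-y+1) (s≤s z≤n)) (subst (_< k) (sym w-at-y+1) m+1<k)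

  inner-symmetric : ∀ a b → MirrorSymmetric w (o + a) (o + b) → b < length Y → MirrorSymmetric Y a b
  inner-symmetric a b sym-w b<Y p q a≤p a≤q eq = +-cancelˡ-≡ k _ _ (begin
    k + Y ! p    ≡⟨ w-at-Y p (≤-<-trans (mirror-≤ a≤q eq) b<Y) ⟨
    w ! (o + p)  ≡⟨ sym-w (o + p) (o + q) (+-monoʳ-≤ o a≤p) (+-monoʳ-≤ o a≤q) shifted ⟩
    w ! (o + q)  ≡⟨ w-at-Y q (≤-<-trans (mirror-≤ a≤p (trans (+-comm q p) eq)) b<Y) ⟩
    k + Y ! q    ∎)
    where
    open ≡-Reasoning
    shifted : o + p + (o + q) ≡ o + a + (o + b)
    shifted = trans (interchange o p o q) (trans (cong (o + o +_) eq) (sym (interchange o a o b)))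

  centres : ∀ a b → MirrorSymmetric w a b → a ≤ c → c < b → b < length w →
    o ≤ a × (a + b ≡ c + c ⊎ a + b ≡ c + c + suc L)
  centres a b sym-ab a≤c c<b b<n
    with a′ , refl ← m≤n⇒∃[o]m+o≡n (left-end-after-X a b sym-ab a≤c c<b b<n)
       | b′ , refl ← m≤n⇒∃[o]m+o≡n (≤-trans (m≤m+n o L) (<⇒≤ c<b)) =
    m≤m+n o a′ ,
    Sum.map (λ eq → trans (interchange o a′ o b′) (trans (cong (o + o +_) eq) (sym (interchange o L o L))))
            (λ eq → trans (interchange o a′ o b′) (trans (cong (o + o +_) eq) (sym interchange₃)))
            (centred-palindromes m U V U<m V-unique a′ b′
              (+-cancelˡ-≤ o a′ L a≤c) (+-cancelˡ-< o L b′ c<b)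
              b′<Y (inner-symmetric a′ b′ sym-ab b′<Y))
    where
    b′<Y : b′ < length Y
    b′<Y = +-cancelˡ-< o b′ (length Y) (subst (o + b′ <_) length-w b<n)
    interchange₃ : c + c + suc L ≡ o + o + (L + L + suc L)
    interchange₃ = trans (cong (_+ suc L) (interchange o L o L)) (+-assoc (o + o) (L + L) (suc L))

  drop-at-U : drop o w ≡ k ⊕ Y
  drop-at-U = trans (cong₂ drop (+-comm 1 (length X)) w-shape) (drop-length-++ X (suc m ∷ k ⊕ Y) 1)

  drop-at-E : drop E w ≡ k ⊕ V
  drop-at-E = begin
    drop E w                                            ≡⟨ cong₂ drop E≡ w-shape ⟩
    drop (length X + suc (suc L)) (X ++ suc m ∷ k ⊕ Y)  ≡⟨ drop-length-++ X (suc m ∷ k ⊕ Y) (suc (suc L)) ⟩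
    drop (suc L) (k ⊕ Y)                                ≡⟨ drop-map (suc L) Y ⟩
    k ⊕ drop (suc L) Y                                  ≡⟨ cong (λ n → k ⊕ drop n Y) (+-comm 1 L) ⟩
    k ⊕ drop (L + 1) Y                                  ≡⟨ cong (k ⊕_) (drop-length-++ U (m ∷ V) 1) ⟩
    k ⊕ V                                               ∎
    where
    open ≡-Reasoning
    E≡ : E ≡ length X + suc (suc L)
    E≡ = trans E-value (sym (trans (+-suc (length X) (suc L)) (cong suc (+-suc (length X) L))))

  factor-in-Y : ∀ M → M ≼ Y → factor w (suc o) (o + length M) ≡ k ⊕ M
  factor-in-Y M M≼Y = trans (factor-take-drop w o (length M))
    (trans (cong (take (length M)) drop-at-U) (trans (take-map (length M) Y) (cong (k ⊕_) (take-≼ M≼Y))))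

  factor-in-V : ∀ M → M ≼ V → factor w (suc E) (E + length M) ≡ k ⊕ M
  factor-in-V M M≼V = trans (factor-take-drop w E (length M))
    (trans (cong (take (length M)) drop-at-E) (trans (take-map (length M) V) (cong (k ⊕_) (take-≼ M≼V))))

  Wm M₁ M₂ : Word
  Wm = U ∷ʳ m
  M₁ = U ++ m ∷ U
  M₂ = U ++ m ∷ M₁

  M₁-palindrome : IsPalindrome M₁
  M₁-palindrome = trans (reverse-++-∷ U m U) (cong (λ u → u ++ m ∷ u) U-palindrome)

  M₁≼M₂ : M₁ ≼ M₂
  M₁≼M₂ = m ∷ U , sym (++-assoc U (m ∷ U) (m ∷ U))

  M₂-palindrome : IsPalindrome M₂
  M₂-palindrome = begin
    reverse (U ++ m ∷ M₁)          ≡⟨ reverse-++-∷ U m M₁ ⟩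
    reverse M₁ ++ m ∷ reverse U    ≡⟨ cong₂ (λ x y → x ++ m ∷ y) M₁-palindrome U-palindrome ⟩
    M₁ ++ m ∷ U                    ≡⟨ proj₂ M₁≼M₂ ⟨
    M₂                             ∎
    where open ≡-Reasoning

  U≼V : U ≼ V
  U≼V = ≼-trans (m ∷ U , refl) UmU≼V

  Wm≼Y : Wm ≼ Y
  Wm≼Y = V , sym (∷ʳ-++ U m V)

  M₂≼Y : M₂ ≼ Y
  M₂≼Y = R , trans (cong (λ v → U ++ m ∷ v) V≡) (sym (++-assoc U (m ∷ M₁) R))
    where
    R = proj₁ UmU≼V
    V≡ = proj₂ UmU≼V

  M₁≼Y : M₁ ≼ Y
  M₁≼Y = ≼-trans M₁≼M₂ M₂≼Y

  t₁ t₂ : ℕ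
  t₁ = o + length M₁
  t₂ = o + length M₂

  E≡o+|Wm| : E ≡ o + length Wm
  E≡o+|Wm| = trans E-value (sym (trans (cong (o +_) (length-++ U)) (shift (length X) L)))
    where
    shift : ∀ x L → suc x + (L + 1) ≡ suc (suc (x + L))
    shift = solve-∀

  o+L+1+|M|≡E+|M| : ∀ (M : Word) → o + (L + suc (length M)) ≡ E + length M
  o+L+1+|M|≡E+|M| M = trans (shift (length X) L (length M)) (cong (_+ length M) (sym E-value))
    where
    shift : ∀ x L n → suc x + (L + suc n) ≡ suc (suc (x + L)) + n
    shift = solve-∀

  t₁≡E+|U| : t₁ ≡ E + length U
  t₁≡E+|U| = trans (cong (o +_) (length-++ U)) (o+L+1+|M|≡E+|M| U)

  t₂≡E+|M₁| : t₂ ≡ E + length M₁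
  t₂≡E+|M₁| = trans (cong (o +_) (length-++ U)) (o+L+1+|M|≡E+|M| M₁)

  straddling : ∀ M → M ≼ Y → IsPalindrome M → E < o + length M → StraddlingIn w E (suc o) (o + length M)
  straddling M M≼Y M-pal E<t =
    s≤s z≤n ,
    subst (suc o ≤_) (sym E-value) (s≤s (m≤m+n o L)) ,
    E<t ,
    subst (o + length M ≤_) (sym length-w) (+-monoʳ-≤ o (≼-length M≼Y)) ,
    subst IsPalindrome (sym (factor-in-Y M M≼Y)) (palindrome-⊕ k M M-pal)

  straddling₁ : StraddlingIn w E (suc o) t₁
  straddling₁ = straddling M₁ M₁≼Y M₁-palindrome (subst (E <_) (sym t₁≡E+|U|) (m<m+n E U-nonempty))

  straddling₂ : StraddlingIn w E (suc o) t₂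
  straddling₂ = straddling M₂ M₂≼Y M₂-palindrome
    (subst (E <_) (sym t₂≡E+|M₁|)
      (m<m+n E (subst (0 <_) (sym (trans (length-++ U) (+-suc L L))) (s≤s z≤n))))

  left-part : factor w (suc o) E ≡ k ⊕ Wm
  left-part = trans (cong (factor w (suc o)) E≡o+|Wm|) (factor-in-Y Wm Wm≼Y)

  ab₁ : ABStraddlingIn w E (k ⊕ Wm) (k ⊕ dropLast Wm) (suc o) t₁
  ab₁ = straddling₁ , left-part ,
        trans (cong (factor w (suc E)) t₁≡E+|U|)
              (trans (factor-in-V U U≼V) (cong (k ⊕_) (sym (dropLast-∷ʳ U m))))

  ab₂ : ABStraddlingIn w E (k ⊕ Wm) (k ⊕ dropLast (Wm ++ Wm)) (suc o) t₂
  ab₂ = straddling₂ , left-part ,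
        trans (cong (factor w (suc E)) t₂≡E+|M₁|) (trans (factor-in-V M₁ UmU≼V) (cong (k ⊕_) (sym WmWm)))
    where
    WmWm : dropLast (Wm ++ Wm) ≡ M₁
    WmWm = trans (cong dropLast (sym (++-assoc Wm U [ m ]))) (trans (dropLast-∷ʳ (Wm ++ U) m) (∷ʳ-++ U m U))

  classify : ∀ s t → StraddlingIn w E s t →
    suc o ≤ s × s ≤ t × (s + t ≡ suc o + t₁ ⊎ s + t ≡ suc o + t₂)
  classify (suc a) (suc b) (_ , s≤E , E<t , t≤n , pal) =
    s≤s o≤a , s≤s (≤-trans a≤c (<⇒≤ c<b)) , Sum.map sum₁ sum₂ sums
    where
    a≤c : a ≤ c
    a≤c = s≤s⁻¹ (subst (suc a ≤_) E-value s≤E)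
    c<b : c < b
    c<b = s≤s⁻¹ (subst (_< suc b) E-value E<t)
    located = centres a b (palindrome⇒mirror-symmetric w a b t≤n pal) a≤c c<b t≤n
    o≤a = proj₁ located
    sums = proj₂ located
    centre₁ : ∀ o L → suc (suc (o + L + (o + L))) ≡ suc o + (o + (L + suc L))
    centre₁ = solve-∀
    centre₂ : ∀ o L → suc (suc (o + L + (o + L) + suc L)) ≡ suc o + (o + (L + suc (L + suc L)))
    centre₂ = solve-∀
    sum₁ : a + b ≡ c + c → suc a + suc b ≡ suc o + t₁
    sum₁ eq = trans (cong suc (+-suc a b)) (trans (cong (suc ∘ suc) eq)
                (trans (centre₁ o L) (cong (λ n → suc o + (o + n)) (sym (length-++ U)))))
    sum₂ : a + b ≡ c + c + suc L → suc a + suc b ≡ suc o + t₂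
    sum₂ eq = trans (cong suc (+-suc a b)) (trans (cong (suc ∘ suc) eq)
                (trans (centre₂ o L) (cong (λ n → suc o + (o + n))
                  (sym (trans (length-++ U) (cong (λ n → L + suc n) (length-++ U)))))))
  classify zero t (() , _)
  classify (suc a) zero (_ , _ , () , _)

  two-maximal : TwoMaximalStraddling k w E Wm
  two-maximal =
    suc o , t₁ , suc o , t₂ , ab₁ , ab₂ ,
    (λ eq → <⇒≢ t₁<t₂ (cong proj₂ eq)) ,
    maximal-two-centres (StraddlingIn w E) (suc o) t₁ t₂ classify straddling₁ straddling₂
    where
    t₁<t₂ : t₁ < t₂
    t₁<t₂ = +-monoʳ-< o (subst (length M₁ <_) (sym (length-++ U)) (m≤n+m (suc (length M₁)) L))

W-around-e : ∀ j m′ → let κ = suc j; k = suc κ; m = suc m′ in suc m ≤ κ →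
  Σ[ X ∈ Word ] W k (k + (k + m′)) ≡ X ++ suc m ∷ k ⊕ (zimin m ++ m ∷ W k (k + m′))
              × e k (k + (k + m′)) ≡ suc (suc (length X + length (zimin m)))
W-around-e j m′ m<κ = X , w-shape , E-value
  where
  open ≡-Reasoning
  κ = suc j
  k = suc κ
  m = suc m′
  d = k + m′
  V Wm Bd Bm Xm X : Word
  V = W k d
  Wm = zimin m ∷ʳ m
  Bd = blocks k (suc (suc d)) j
  Bm = blocks k (suc (suc m)) j
  Xm = Bm ++ zimin (suc m)
  X = Bd ++ Xm

  W-after-d : W k (suc d) ≡ Xm ++ suc m ∷ k ⊕ Wm
  W-after-d = begin
    W k (suc d)                                   ≡⟨ cong (W k) (+-suc k m′) ⟨
    W k (k + m)                                   ≡⟨ W-decomposition κ m ⟩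
    (Bm ++ W k (suc m)) ++ k ⊕ W k m              ≡⟨ cong₂ (λ x y → (Bm ++ x) ++ k ⊕ y)
                                                             (W-zimin κ (suc m) m<κ) (W-zimin κ m (<⇒≤ m<κ)) ⟩
    (Bm ++ (zimin (suc m) ∷ʳ suc m)) ++ k ⊕ Wm    ≡⟨ cong (_++ k ⊕ Wm) (++-assoc Bm (zimin (suc m)) [ suc m ]) ⟨
    (Xm ∷ʳ suc m) ++ k ⊕ Wm                       ≡⟨ ∷ʳ-++ Xm (suc m) (k ⊕ Wm) ⟩
    Xm ++ suc m ∷ k ⊕ Wm                          ∎

  prefix-shape : blocks k (suc d) κ ≡ X ++ suc m ∷ k ⊕ Wm
  prefix-shape = trans (cong (Bd ++_) W-after-d) (sym (++-assoc Bd Xm _))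

  w-shape : W k (k + d) ≡ X ++ suc m ∷ k ⊕ (zimin m ++ m ∷ V)
  w-shape = begin
    W k (k + d)                              ≡⟨ W-decomposition κ d ⟩
    blocks k (suc d) κ ++ k ⊕ V              ≡⟨ cong (_++ k ⊕ V) prefix-shape ⟩
    (X ++ suc m ∷ k ⊕ Wm) ++ k ⊕ V           ≡⟨ ++-assoc X (suc m ∷ k ⊕ Wm) (k ⊕ V) ⟩
    X ++ suc m ∷ (k ⊕ Wm ++ k ⊕ V)           ≡⟨ cong (λ x → X ++ suc m ∷ x) (map-++ (k +_) Wm V) ⟨
    X ++ suc m ∷ k ⊕ (Wm ++ V)               ≡⟨ cong (λ x → X ++ suc m ∷ k ⊕ x) (∷ʳ-++ (zimin m) m V) ⟩
    X ++ suc m ∷ k ⊕ (zimin m ++ m ∷ V)      ∎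

  E-value : e k (k + d) ≡ suc (suc (length X + length (zimin m)))
  E-value = begin
    e k (k + d)                              ≡⟨ e-blocks κ d ⟩
    length (blocks k (suc d) κ)              ≡⟨ cong length prefix-shape ⟩
    length (X ++ suc m ∷ k ⊕ Wm)             ≡⟨ length-++ X ⟩
    length X + suc (length (k ⊕ Wm))         ≡⟨ cong (λ n → length X + suc n) (trans (length-map (k +_) Wm) (length-++ (zimin m))) ⟩
    length X + suc (length (zimin m) + 1)    ≡⟨ shift (length X) (length (zimin m)) ⟩
    suc (suc (length X + length (zimin m)))  ∎
    where
    shift : ∀ x L → x + suc (L + 1) ≡ suc (suc (x + L))
    shift = solve-∀

W-two-maximal-straddling : ∀ j m′ → let k = suc (suc (suc j)); m = suc m′; n = k + (k + m′) in
  suc m < k → TwoMaximalStraddling k (W k n) (e k n) (W k m)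
W-two-maximal-straddling j m′ m+1<k with X , w-shape , E-value ← W-around-e (suc j) m′ (s≤s⁻¹ m+1<k) =
  subst (TwoMaximalStraddling k (W k n) (e k n)) (sym (W-zimin κ m (<⇒≤ (s≤s⁻¹ m+1<k))))
    (Straddle.two-maximal k m X (zimin m) (W k (k + m′)) (W k n) (e k n) w-shape E-value m+1<k
      (W-ZeroBeforeSmall κ (κ + (k + m′)))
      (zimin-nonempty m′) (zimin-< m) (zimin-palindrome m)
      (zimin-≼-W (suc j) (suc m) m′ (s≤s⁻¹ m+1<k))
      (W-palindromic-prefix (suc j) m′ m m+1<k))
  where
  κ = suc (suc j)
  k = suc κ
  m = suc m′
  n = k + (k + m′)

-- Once k = 3 + j, both 2 * k ∸ 1 and 3 * k ∸ 2 reduce to ∸-free terms, which is the form the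
-- ring-solver equations below are stated in.
middle-range : ∀ j n → let k = suc (suc (suc j)) in 2 * k ∸ 1 < n → n < 3 * k ∸ 2 →
  Σ[ m′ ∈ ℕ ] n ≡ k + (k + m′) × n ∸ (2 * k ∸ 1) ≡ suc m′ × suc (suc m′) < k
middle-range j n lo hi with m′ , refl ← m≤n⇒∃[o]m+o≡n lo =
  m′ , n≡ j m′ , m≡ , s≤s (s≤s (s≤s m′≤j))
  where
  x = 2 * suc (suc (suc j)) ∸ 1
  n≡ : ∀ j m′ → suc (suc (suc j) + (suc (suc (suc j)) + 0)) + m′
                 ≡ suc (suc (suc j)) + (suc (suc (suc j)) + m′)
  n≡ = solve-∀
  m≡ : suc x + m′ ∸ x ≡ suc m′
  m≡ = trans (cong (_∸ x) (sym (+-suc x m′))) (m+n∸m≡n x (suc m′))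
  3k-2≡ : ∀ j → suc j + (suc (suc (suc j)) + (suc (suc (suc j)) + 0))
                ≡ suc (suc (suc j) + (suc (suc (suc j)) + 0)) + suc j
  3k-2≡ = solve-∀
  m′≤j : m′ ≤ j
  m′≤j = s≤s⁻¹ (+-cancelˡ-≤ (suc x) (suc m′) (suc j) (subst₂ _≤_ (sym (+-suc (suc x) m′)) (3k-2≡ j) hi))

lemma5p15 : (k n : ℕ) → 3 ≤ k → 2 * k ∸ 1 < n → n < 3 * k ∸ 2 →
    let m = n ∸ (2 * k ∸ 1) in
    Σ[ s₁ ∈ ℕ ] Σ[ t₁ ∈ ℕ ] Σ[ s₂ ∈ ℕ ] Σ[ t₂ ∈ ℕ ]
      ( ABStraddling k n (k ⊕ W k m) (k ⊕ dropLast (W k m)) s₁ t₁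
      × ABStraddling k n (k ⊕ W k m) (k ⊕ dropLast (W k m ++ W k m)) s₂ t₂
      × (s₁ , t₁) ≢ (s₂ , t₂)
      × (∀ s t → Maximal k n s t ⇔ ((s , t) ≡ (s₁ , t₁) ⊎ (s , t) ≡ (s₂ , t₂))) )
lemma5p15 k@(suc (suc (suc j))) n (s≤s (s≤s (s≤s z≤n))) lo hi
  with m′ , refl , m≡ , m+1<k ← middle-range j n lo hi =
  subst (λ m → TwoMaximalStraddling k (W k n) (e k n) (W k m)) (sym m≡) (W-two-maximal-straddling j m′ m+1<k)
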